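{- Let $\mathsf{P}$ be a property of r.e. theories, let $\mathsf{D_P}$ be the collection of r.e. theories with $\mathsf{P}$, and let $\sqsubseteq$ be a reflexive and transitive binary relation on r.e. theories. Suppose that for some $n\in\omega$: (1) for any $A,B\in\mathsf{D_P}$ there is a lower bound $A\oplus B\in\mathsf{D_P}$ of $A$ and $B$ under $\sqsubseteq$; (2) if $A\in\mathsf{D_P}$ and $A\sqsubseteq B$ then $B\in\mathsf{D_P}$; (3) the relation $A\sqsubseteq B$ (on indices of r.e. theories) is $\Sigma^0_n$; (4) $\{e: W_e\text{ has property }\mathsf{P}\}$ is $\Pi^0_n$-complete. Then $\langle\mathsf{D_P},\sqsubseteq\rangle$ has no minimal element, i.e. there is no $S\in\mathsf{D_P}$ such that no $T\in\mathsf{D_P}$ satisfies $T\sqsubset S$.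
   Context: $W_e$ is the $e$-th r.e. set, regarded as the r.e. theory with index $e$. $T\sqsubset S$ means $T\sqsubseteq S$ and not $S\sqsubseteq T$. -}

module Defs where

open import Data.Nat using (ℕ; zero; suc; _+_; _<_)
open import Data.Product using (Σ; ∃; _×_; _,_; proj₁; proj₂)
open import Relation.Nullary using (¬_)
open import Function.Bundles using (_⇔_)

-- Cantor pairing.  unpair enumerates ℕ × ℕ along anti-diagonals:
-- (0,0),(0,1),(1,0),(0,2),(1,1),(2,0),...   and  pair is its inverse.

tri : ℕ → ℕ
tri zero    = zero
tri (suc d) = suc d + tri d

pair : ℕ → ℕ → ℕ
pair a b = tri (a + b) + a

next : ℕ × ℕ → ℕ × ℕ
next (a , suc b) = (suc a , b)
next (a , zero)  = (zero , suc a)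

unpair : ℕ → ℕ × ℕ
unpair zero    = (zero , zero)
unpair (suc n) = next (unpair n)

fst snd : ℕ → ℕ
fst n = proj₁ (unpair n)
snd n = proj₂ (unpair n)

-- A standard model of computation: unary partial recursive functions
-- (with pairing), in the style of R. M. Robinson.

data Code : Set where
  zero' succ' id' fst' snd' : Code
  pair' comp' rec'          : Code → Code → Code
  mu'                       : Code → Code

data Eval : Code → ℕ → ℕ → Set where
  ev-zero : ∀ {x} → Eval zero' x zero
  ev-succ : ∀ {x} → Eval succ' x (suc x)
  ev-id   : ∀ {x} → Eval id' x x
  ev-fst  : ∀ {x} → Eval fst' x (fst x)
  ev-snd  : ∀ {x} → Eval snd' x (snd x)
  ev-pair : ∀ {f g x a b} → Eval f x a → Eval g x b → Eval (pair' f g) x (pair a b)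
  ev-comp : ∀ {f g x y z} → Eval g x y → Eval f y z → Eval (comp' f g) x z
  ev-rec0 : ∀ {f g a v} → Eval f a v → Eval (rec' f g) (pair a zero) v
  ev-recS : ∀ {f g a m w v} → Eval (rec' f g) (pair a m) w →
            Eval g (pair a (pair m w)) v → Eval (rec' f g) (pair a (suc m)) v
  ev-mu   : ∀ {f x n} → Eval f (pair x n) zero →
            (∀ m → m < n → Σ ℕ λ k → Eval f (pair x m) (suc k)) →
            Eval (mu' f) x n

-- Gödel numbering of programs (surjective): an index n ≠ 0 decodes via
-- unpair n = (tag , r), children taken from unpair r.

decodeF : ℕ → ℕ → Code
decodeF zero    _ = zero'
decodeF (suc k) n with unpair n
... | (0 , r) = zero'
... | (1 , r) = succ'
... | (2 , r) = id'
... | (3 , r) = fst'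
... | (4 , r) = snd'
... | (5 , r) = pair' (decodeF k (fst r)) (decodeF k (snd r))
... | (6 , r) = comp' (decodeF k (fst r)) (decodeF k (snd r))
... | (7 , r) = rec' (decodeF k (fst r)) (decodeF k (snd r))
... | (8 , r) = mu' (decodeF k r)
... | (_ , r) = zero'

decode : ℕ → Code
decode n = decodeF (suc n) n

φ : ℕ → ℕ → ℕ → Set
φ e x y = Eval (decode e) x y

-- W_e = domain of φ_e  (the e-th r.e. set / r.e. theory with index e)
W : ℕ → ℕ → Set
W e x = Σ ℕ λ y → φ e x y

SameW : ℕ → ℕ → Set
SameW e e' = ∀ x → W e x ⇔ W e' x

Total : Code → Set
Total c = ∀ x → Σ ℕ λ y → Eval c x y

-- Σ_n-formula with recursive matrix given by the total program c:
--   Σ_0 : c(x) = 0 ;  Σ_{n+1} : ∃ y. ¬ Σ_n(⟨x,y⟩)   (i.e. ∃ y Π_n)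
SigmaF : ℕ → Code → ℕ → Set
SigmaF zero    c x = Eval c x zero
SigmaF (suc n) c x = Σ ℕ λ y → ¬ SigmaF n c (pair x y)

IsΣ⁰ : ℕ → (ℕ → Set) → Set
IsΣ⁰ n A = Σ Code λ c → Total c × (∀ x → A x ⇔ SigmaF n c x)

IsΠ⁰ : ℕ → (ℕ → Set) → Set
IsΠ⁰ n A = Σ Code λ c → Total c × (∀ x → A x ⇔ (¬ SigmaF n c x))

IsΣ⁰₂ : ℕ → (ℕ → ℕ → Set) → Set
IsΣ⁰₂ n R = Σ Code λ c → Total c × (∀ a b → R a b ⇔ SigmaF n c (pair a b))

_≤m_ : (ℕ → Set) → (ℕ → Set) → Set
B ≤m A = Σ Code λ d → Σ (ℕ → ℕ) λ f →
           (∀ x → Eval d x (f x)) × (∀ x → B x ⇔ A (f x))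

IsΠ⁰-complete : ℕ → (ℕ → Set) → Set₁
IsΠ⁰-complete n A = IsΠ⁰ n A × (∀ (B : ℕ → Set) → IsΠ⁰ n B → B ≤m A)

-- If S were minimal, a lower bound c ∈ D_P of S and x with ¬ S ⊑ c would be
-- strictly below S, so ¬ P x ⇔ ¬ S ⊑ x: the complement of P is Π⁰ₙ. By
-- completeness it reduces to P via a computable f, and Kleene's recursion
-- theorem gives e with W_e = W_{f e}; as P depends only on W_e, P e ⇔ ¬ P e.
-- The recursion theorem needs a universal program: it runs a small-step
-- machine, whose step function is a total program on coded states, up to the
-- first final state, found by μ-search.
{-# OPTIONS --safe #-}
module Submission where

open import Defs
open import Data.Nat using (ℕ; zero; suc; pred; _+_; _∸_; _≤_; _<_; z≤n; s≤s; _≟_)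
open import Data.Nat.Properties
open import Data.Nat.Induction using (<-wellFounded)
open import Data.Product using (Σ; _×_; _,_; proj₁; proj₂)
open import Data.Empty using (⊥-elim)
open import Data.List using (List; []; _∷_)
open import Function using (_∘_; _$_)
open import Function.Bundles using (_⇔_; mk⇔; Equivalence)
open import Function.Properties.Equivalence using (⇔-isEquivalence)
open import Induction.WellFounded using (Acc; acc)
open import Relation.Binary using (tri<; tri≈; tri>)
open import Relation.Binary.PropositionalEquality
open import Relation.Binary.Structures using (IsEquivalence)
open import Level using (0ℓ)
open import Relation.Nullary using (¬_; Dec; yes; no)

unpair-tri+ : ∀ d a → a ≤ d → unpair (tri d + a) ≡ (a , d ∸ a)
unpair-tri+ zero .zero z≤n = refl
unpair-tri+ (suc d) = go
  where
  go : ∀ a → a ≤ suc d → unpair (tri (suc d) + a) ≡ (a , suc d ∸ a)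
  go zero _ = begin
    unpair (tri (suc d) + 0)       ≡⟨ cong unpair (trans (+-identityʳ _) (cong suc (+-comm d (tri d)))) ⟩
    next (unpair (tri d + d))      ≡⟨ cong next (unpair-tri+ d d ≤-refl) ⟩
    next (d , d ∸ d)               ≡⟨ cong (λ r → next (d , r)) (n∸n≡0 d) ⟩
    (0 , suc d)                    ∎
    where open ≡-Reasoning
  go (suc a) (s≤s a≤d) = begin
    unpair (tri (suc d) + suc a)   ≡⟨ cong unpair (+-suc (tri (suc d)) a) ⟩
    next (unpair (tri (suc d) + a)) ≡⟨ cong next (go a (m≤n⇒m≤1+n a≤d)) ⟩
    next (a , suc d ∸ a)           ≡⟨ cong (λ r → next (a , r)) (+-∸-assoc 1 a≤d) ⟩
    (suc a , d ∸ a)                ∎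
    where open ≡-Reasoning

unpair-pair : ∀ a b → unpair (pair a b) ≡ (a , b)
unpair-pair a b rewrite unpair-tri+ (a + b) a (m≤m+n a b) | m+n∸m≡n a b = refl

fst-pair : ∀ a b → fst (pair a b) ≡ a
fst-pair a b = cong proj₁ (unpair-pair a b)

snd-pair : ∀ a b → snd (pair a b) ≡ b
snd-pair a b = cong proj₂ (unpair-pair a b)

pair-fst-snd : ∀ n → pair (fst n) (snd n) ≡ n
pair-fst-snd zero = refl
pair-fst-snd (suc n) with unpair n | pair-fst-snd n
... | (a , suc b) | eq rewrite +-suc a b = trans (+-suc _ a) (cong suc eq)
... | (a , zero)  | eq rewrite +-identityʳ a =
  trans (+-identityʳ _) (cong suc (trans (+-comm a (tri a)) eq))

pair-injective : ∀ {a b a' b'} → pair a b ≡ pair a' b' → a ≡ a' × b ≡ b'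
pair-injective {a} {b} {a'} {b'} eq =
  trans (sym (fst-pair a b)) (trans (cong fst eq) (fst-pair a' b')) ,
  trans (sym (snd-pair a b)) (trans (cong snd eq) (snd-pair a' b'))

unpair≡⇒≡pair : ∀ {n a b} → unpair n ≡ (a , b) → n ≡ pair a b
unpair≡⇒≡pair {n} eq = trans (sym (pair-fst-snd n)) (cong (λ p → pair (proj₁ p) (proj₂ p)) eq)

n≤tri : ∀ n → n ≤ tri n
n≤tri zero    = z≤n
n≤tri (suc n) = m≤m+n (suc n) (tri n)

m≤pair : ∀ m n → m ≤ pair m n
m≤pair m n = m≤n+m m (tri (m + n))

n≤pair : ∀ m n → n ≤ pair m n
n≤pair m n = ≤-trans (m≤n+m n m) (≤-trans (n≤tri (m + n)) (m≤m+n (tri (m + n)) m))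

n<pair-suc : ∀ m n → n < pair (suc m) n
n<pair-suc m n = ≤-trans (s≤s (m≤n+m n m)) (≤-trans (n≤tri (suc (m + n))) (m≤m+n _ (suc m)))

fst≤ : ∀ n → fst n ≤ n
fst≤ n = subst (fst n ≤_) (pair-fst-snd n) (m≤pair (fst n) (snd n))

snd≤ : ∀ n → snd n ≤ n
snd≤ n = subst (snd n ≤_) (pair-fst-snd n) (n≤pair (fst n) (snd n))

Eval-det : ∀ {c x x' y y'} → Eval c x y → Eval c x' y' → x ≡ x' → y ≡ y'
Eval-det ev-zero ev-zero _ = refl
Eval-det ev-succ ev-succ eq = cong suc eq
Eval-det ev-id ev-id eq = eq
Eval-det ev-fst ev-fst eq = cong fst eq
Eval-det ev-snd ev-snd eq = cong snd eq
Eval-det (ev-pair d₁ d₂) (ev-pair d₁' d₂') eq = cong₂ pair (Eval-det d₁ d₁' eq) (Eval-det d₂ d₂' eq)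
Eval-det (ev-comp d₁ d₂) (ev-comp d₁' d₂') eq = Eval-det d₂ d₂' (Eval-det d₁ d₁' eq)
Eval-det (ev-rec0 {a = a} d) (ev-rec0 {a = a'} d') eq =
  Eval-det d d' (proj₁ (pair-injective {a} {0} {a'} {0} eq))
Eval-det (ev-rec0 {a = a} _) (ev-recS {a = a'} {m = m} _ _) eq
  with () ← proj₂ (pair-injective {a} {0} {a'} {suc m} eq)
Eval-det (ev-recS {a = a} {m = m} _ _) (ev-rec0 {a = a'} _) eq
  with () ← proj₂ (pair-injective {a} {suc m} {a'} {0} eq)
Eval-det (ev-recS {a = a} {m = m} dr dg) (ev-recS {a = a'} {m = m'} dr' dg') eq
  with pair-injective {a} {suc m} {a'} {suc m'} eq
... | refl , refl = Eval-det dg dg' (cong (pair a) (cong (pair m) (Eval-det dr dr' refl)))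
Eval-det (ev-mu {n = n} d₀ h) (ev-mu {n = n'} d₀' h') eq with <-cmp n n'
... | tri≈ _ n≡n' _ = n≡n'
... | tri< n<n' _ _ with () ← Eval-det d₀ (proj₂ (h' n n<n')) (cong (λ z → pair z n) eq)
... | tri> _ _ n>n' with () ← Eval-det (proj₂ (h n' n>n')) d₀' (cong (λ z → pair z n') eq)

child< : ∀ {n t r} → unpair n ≡ (suc t , r) → r < n
child< {t = t} {r} eq = subst (r <_) (sym (unpair≡⇒≡pair eq)) (n<pair-suc t r)

fst-child< : ∀ {n t r} → unpair n ≡ (suc t , r) → fst r < n
fst-child< {r = r} eq = ≤-<-trans (fst≤ r) (child< eq)

snd-child< : ∀ {n t r} → unpair n ≡ (suc t , r) → snd r < n
snd-child< {r = r} eq = ≤-<-trans (snd≤ r) (child< eq)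

decodeF-suc-cong : ∀ {k k'} n → (∀ m → m < n → decodeF k m ≡ decodeF k' m) →
                   decodeF (suc k) n ≡ decodeF (suc k') n
decodeF-suc-cong n IH with unpair n in eq
... | (0 , r) = refl
... | (1 , r) = refl
... | (2 , r) = refl
... | (3 , r) = refl
... | (4 , r) = refl
... | (5 , r) = cong₂ pair' (IH (fst r) (fst-child< eq)) (IH (snd r) (snd-child< eq))
... | (6 , r) = cong₂ comp' (IH (fst r) (fst-child< eq)) (IH (snd r) (snd-child< eq))
... | (7 , r) = cong₂ rec' (IH (fst r) (fst-child< eq)) (IH (snd r) (snd-child< eq))
... | (8 , r) = cong mu' (IH r (child< eq))
... | (suc (suc (suc (suc (suc (suc (suc (suc (suc _)))))))) , r) = refl

decodeF-stable : ∀ k k' n → n < k → n < k' → decodeF k n ≡ decodeF k' n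
decodeF-stable (suc k) (suc k') n (s≤s n≤k) (s≤s n≤k') = decodeF-suc-cong n
  (λ m m<n → decodeF-stable k k' m (<-≤-trans m<n n≤k) (<-≤-trans m<n n≤k'))

decodeF-below : ∀ e m → m < e → decodeF e m ≡ decode m
decodeF-below e m m<e = decodeF-stable e (suc m) m m<e ≤-refl

-- The outermost constructor of decode e, with the indices of its children.
data CodeView : Set where
  vzero vsucc vid vfst vsnd : CodeView
  vpair vcomp vrec          : ℕ → ℕ → CodeView
  vmu                       : ℕ → CodeView

viewOf : ℕ × ℕ → CodeView
viewOf (0 , r) = vzero
viewOf (1 , r) = vsucc
viewOf (2 , r) = vid
viewOf (3 , r) = vfst
viewOf (4 , r) = vsnd
viewOf (5 , r) = vpair (fst r) (snd r)
viewOf (6 , r) = vcomp (fst r) (snd r)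
viewOf (7 , r) = vrec (fst r) (snd r)
viewOf (8 , r) = vmu r
viewOf (suc (suc (suc (suc (suc (suc (suc (suc (suc _)))))))) , r) = vzero

view : ℕ → CodeView
view e = viewOf (unpair e)

realize : CodeView → Code
realize vzero       = zero'
realize vsucc       = succ'
realize vid         = id'
realize vfst        = fst'
realize vsnd        = snd'
realize (vpair a b) = pair' (decode a) (decode b)
realize (vcomp a b) = comp' (decode a) (decode b)
realize (vrec a b)  = rec' (decode a) (decode b)
realize (vmu a)     = mu' (decode a)

decode-view : ∀ e → decode e ≡ realize (view e)
decode-view e with unpair e in eq
... | (0 , r) = refl
... | (1 , r) = refl
... | (2 , r) = refl
... | (3 , r) = refl
... | (4 , r) = refl
... | (5 , r) = cong₂ pair' (decodeF-below e (fst r) (fst-child< eq)) (decodeF-below e (snd r) (snd-child< eq))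
... | (6 , r) = cong₂ comp' (decodeF-below e (fst r) (fst-child< eq)) (decodeF-below e (snd r) (snd-child< eq))
... | (7 , r) = cong₂ rec' (decodeF-below e (fst r) (fst-child< eq)) (decodeF-below e (snd r) (snd-child< eq))
... | (8 , r) = cong mu' (decodeF-below e r (child< eq))
... | (suc (suc (suc (suc (suc (suc (suc (suc (suc _)))))))) , r) = refl

decode≡realize : ∀ {e w} → view e ≡ w → decode e ≡ realize w
decode≡realize {e} ve = trans (decode-view e) (cong realize ve)

encode : Code → ℕ
encode zero'       = 0
encode succ'       = pair 1 0
encode id'         = pair 2 0
encode fst'        = pair 3 0
encode snd'        = pair 4 0
encode (pair' f g) = pair 5 (pair (encode f) (encode g))
encode (comp' f g) = pair 6 (pair (encode f) (encode g))
encode (rec' f g)  = pair 7 (pair (encode f) (encode g))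
encode (mu' f)     = pair 8 (encode f)

decode-node : ∀ t r → decode (pair t r) ≡ realize (viewOf (t , r))
decode-node t r = decode≡realize (cong viewOf (unpair-pair t r))

decode-node₂ : ∀ (op : Code → Code → Code) t →
               (∀ r → realize (viewOf (t , r)) ≡ op (decode (fst r)) (decode (snd r))) →
               ∀ a b → decode (pair t (pair a b)) ≡ op (decode a) (decode b)
decode-node₂ op t realize-t a b = begin
  decode (pair t (pair a b))                         ≡⟨ decode-node t (pair a b) ⟩
  realize (viewOf (t , pair a b))                    ≡⟨ realize-t (pair a b) ⟩
  op (decode (fst (pair a b))) (decode (snd (pair a b)))
    ≡⟨ cong₂ (λ a' b' → op (decode a') (decode b')) (fst-pair a b) (snd-pair a b) ⟩
  op (decode a) (decode b)                           ∎
  where open ≡-Reasoning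

decode-encode : ∀ c → decode (encode c) ≡ c
decode-encode zero' = refl
decode-encode succ' = refl
decode-encode id'   = refl
decode-encode fst'  = refl
decode-encode snd'  = refl
decode-encode (pair' f g) = trans (decode-node₂ pair' 5 (λ _ → refl) (encode f) (encode g))
                                  (cong₂ pair' (decode-encode f) (decode-encode g))
decode-encode (comp' f g) = trans (decode-node₂ comp' 6 (λ _ → refl) (encode f) (encode g))
                                  (cong₂ comp' (decode-encode f) (decode-encode g))
decode-encode (rec' f g)  = trans (decode-node₂ rec' 7 (λ _ → refl) (encode f) (encode g))
                                  (cong₂ rec' (decode-encode f) (decode-encode g))
decode-encode (mu' f)     = trans (decode-node 8 (encode f)) (cong mu' (decode-encode f))

-- A small-step machine evaluating code indices

-- Frames store only natural numbers (code indices and values), so that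
-- machine states can themselves be coded by numbers.
data Frame : Set where
  FComp  : ℕ → Frame
  FPair₁ : ℕ → ℕ → Frame
  FPair₂ : ℕ → Frame
  FRec   : ℕ → ℕ → ℕ → Frame
  FMu    : ℕ → ℕ → ℕ → Frame

data Ctrl : Set where
  Ev  : ℕ → ℕ → Ctrl
  Ret : ℕ → Ctrl

State : Set
State = List Frame × Ctrl

final : ℕ → State
final v = [] , Ret v

recStep : List Frame → ℕ → ℕ → ℕ → ℕ → ℕ → State
recStep K e a b u zero    = K , Ev a u
recStep K e a b u (suc m) = FRec b u m ∷ K , Ev e (pair u m)

stepEv : List Frame → ℕ → ℕ → CodeView → State
stepEv K e x vzero       = K , Ret 0
stepEv K e x vsucc       = K , Ret (suc x)
stepEv K e x vid         = K , Ret x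
stepEv K e x vfst        = K , Ret (fst x)
stepEv K e x vsnd        = K , Ret (snd x)
stepEv K e x (vpair a b) = FPair₁ b x ∷ K , Ev a x
stepEv K e x (vcomp a b) = FComp a ∷ K , Ev b x
stepEv K e x (vrec a b)  = recStep K e a b (fst x) (snd x)
stepEv K e x (vmu a)     = FMu a x 0 ∷ K , Ev a (pair x 0)

step : State → State
step (K , Ev e x)                    = stepEv K e x (view e)
step ([] , Ret v)                    = [] , Ret v
step (FComp a ∷ K , Ret y)           = K , Ev a y
step (FPair₁ b x ∷ K , Ret y)        = FPair₂ y ∷ K , Ev b x
step (FPair₂ a ∷ K , Ret y)          = K , Ret (pair a y)
step (FRec b a m ∷ K , Ret w)        = K , Ev b (pair a (pair m w))
step (FMu a x n ∷ K , Ret zero)      = K , Ret n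
step (FMu a x n ∷ K , Ret (suc _))   = FMu a x (suc n) ∷ K , Ev a (pair x (suc n))

run : State → ℕ → State
run s zero    = s
run s (suc k) = run (step s) k

run-+ : ∀ s j k → run s (j + k) ≡ run (run s j) k
run-+ s zero    k = refl
run-+ s (suc j) k = run-+ (step s) j k

run-suc : ∀ s k → run s (suc k) ≡ step (run s k)
run-suc s zero    = refl
run-suc s (suc k) = run-suc (step s) k

run-final : ∀ v k → run (final v) k ≡ final v
run-final v zero    = refl
run-final v (suc k) = run-final v k

_↝_ : State → State → Set
s ↝ t = Σ ℕ λ k → run s k ≡ t

infixr 5 _▸_
_▸_ : ∀ {s t u} → s ↝ t → t ↝ u → s ↝ u
_▸_ {s} (j , p) (k , q) = j + k , trans (run-+ s j k) (trans (cong (λ z → run z k) p) q)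

↝-step : ∀ {s t} → step s ≡ t → s ↝ t
↝-step p = 1 , p

mutual
  Eval⇒↝ : ∀ {e x y} → Eval (decode e) x y → ∀ K → (K , Ev e x) ↝ (K , Ret y)
  Eval⇒↝ {e} d = Eval⇒↝-view d e (view e) refl (sym (decode-view e))

  Eval⇒↝-view : ∀ {c x y} → Eval c x y → ∀ e w → view e ≡ w → realize w ≡ c →
                ∀ K → (K , Ev e x) ↝ (K , Ret y)
  Eval⇒↝-view ev-zero e vzero ve refl K = ↝-step (cong (stepEv K e _) ve)
  Eval⇒↝-view ev-succ e vsucc ve refl K = ↝-step (cong (stepEv K e _) ve)
  Eval⇒↝-view ev-id   e vid   ve refl K = ↝-step (cong (stepEv K e _) ve)
  Eval⇒↝-view ev-fst  e vfst  ve refl K = ↝-step (cong (stepEv K e _) ve)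
  Eval⇒↝-view ev-snd  e vsnd  ve refl K = ↝-step (cong (stepEv K e _) ve)
  Eval⇒↝-view {x = x} (ev-pair {a = y₁} d₁ d₂) e (vpair a b) ve refl K =
    ↝-step (cong (stepEv K e _) ve) ▸ Eval⇒↝ d₁ (FPair₁ b x ∷ K) ▸ ↝-step refl
    ▸ Eval⇒↝ d₂ (FPair₂ y₁ ∷ K) ▸ ↝-step refl
  Eval⇒↝-view (ev-comp d₁ d₂) e (vcomp a b) ve refl K =
    ↝-step (cong (stepEv K e _) ve) ▸ Eval⇒↝ d₁ (FComp a ∷ K) ▸ ↝-step refl ▸ Eval⇒↝ d₂ K
  Eval⇒↝-view (ev-rec0 {a = u} d) e (vrec a b) ve refl K =
    ↝-step (trans (cong (stepEv K e _) ve) (cong₂ (recStep K e a b) (fst-pair u 0) (snd-pair u 0)))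
    ▸ Eval⇒↝ d K
  Eval⇒↝-view (ev-recS {a = u} {m = m} dr dg) e (vrec a b) ve refl K =
    ↝-step (trans (cong (stepEv K e _) ve) (cong₂ (recStep K e a b) (fst-pair u (suc m)) (snd-pair u (suc m))))
    ▸ Eval⇒↝-view dr e (vrec a b) ve refl (FRec b u m ∷ K) ▸ ↝-step refl ▸ Eval⇒↝ dg K
  Eval⇒↝-view {x = x} (ev-mu {n = n} d₀ below) e (vmu a) ve refl K =
    ↝-step (cong (stepEv K e _) ve) ▸ search n 0 refl
    where
    search : ∀ d j → j + d ≡ n → (FMu a x j ∷ K , Ev a (pair x j)) ↝ (K , Ret n)
    search zero j j+0≡n rewrite +-identityʳ j | j+0≡n = Eval⇒↝ d₀ (FMu a x n ∷ K) ▸ ↝-step refl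
    search (suc d) j j+d≡n with below j (subst (j <_) j+d≡n (m<m+n j (s≤s z≤n)))
    ... | _ , dj = Eval⇒↝ dj (FMu a x j ∷ K) ▸ ↝-step refl ▸ search d (suc j) (trans (sym (+-suc j d)) j+d≡n)

HaltsWithin : State → ℕ → ℕ → Set
HaltsWithin s k v = Σ ℕ λ j → j < k × run s j ≡ final v

HaltsWithin-mono : ∀ {s k k' v} → k ≤ k' → HaltsWithin s k v → HaltsWithin s k' v
HaltsWithin-mono k≤k' (j , j<k , r) = j , <-≤-trans j<k k≤k' , r

HaltsWithin-pop : ∀ {F K c k v} → HaltsWithin (F ∷ K , c) k v → HaltsWithin (step (F ∷ K , c)) k v
HaltsWithin-pop (zero  , _   , ())
HaltsWithin-pop (suc j , j<k , r) = j , <-trans (n<1+n j) j<k , r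

Returns : Code → ℕ → List Frame → ℕ → ℕ → Set
Returns c x K k v = Σ ℕ λ y → Eval c x y × HaltsWithin (K , Ret y) k v

MuReturns : ℕ → ℕ → ℕ → List Frame → ℕ → ℕ → Set
MuReturns a x j K k v = Σ ℕ λ n → Eval (decode a) (pair x n) zero ×
  (∀ m → j ≤ m → m < n → Σ ℕ λ k' → Eval (decode a) (pair x m) (suc k')) ×
  HaltsWithin (K , Ret n) k v

-- Well-founded recursion on the length of the run: each sub-evaluation
-- returns strictly before the run ends.
mutual
  ↝-sound : ∀ k → Acc _<_ k → ∀ e x K v → run (K , Ev e x) k ≡ final v → Returns (decode e) x K k v
  ↝-sound zero _ e x K v ()
  ↝-sound (suc k) (acc rs) e x K v r with stepEv-sound k (rs ≤-refl) e (view e) refl x K v r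
  ... | y , d , h = y , subst (λ c → Eval c x y) (sym (decode-view e)) d , h

  stepEv-sound : ∀ k → Acc _<_ k → ∀ e w → view e ≡ w → ∀ x K v → run (stepEv K e x w) k ≡ final v →
                 Returns (realize w) x K (suc k) v
  stepEv-sound k _ e vzero _ x K v r = 0     , ev-zero , k , ≤-refl , r
  stepEv-sound k _ e vsucc _ x K v r = suc x , ev-succ , k , ≤-refl , r
  stepEv-sound k _ e vid   _ x K v r = x     , ev-id   , k , ≤-refl , r
  stepEv-sound k _ e vfst  _ x K v r = fst x , ev-fst  , k , ≤-refl , r
  stepEv-sound k _ e vsnd  _ x K v r = snd x , ev-snd  , k , ≤-refl , r
  stepEv-sound k ac@(acc rs) e (vpair a b) _ x K v r with ↝-sound k ac a x (FPair₁ b x ∷ K) v r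
  ... | y₁ , d₁ , h₁ with HaltsWithin-pop h₁
  ... | j , j<k , r₁ with ↝-sound j (rs j<k) b x (FPair₂ y₁ ∷ K) v r₁
  ... | y₂ , d₂ , h₂ = pair y₁ y₂ , ev-pair d₁ d₂ , HaltsWithin-mono (m<n⇒m≤1+n j<k) (HaltsWithin-pop h₂)
  stepEv-sound k ac@(acc rs) e (vcomp a b) _ x K v r with ↝-sound k ac b x (FComp a ∷ K) v r
  ... | y₁ , d₁ , h₁ with HaltsWithin-pop h₁
  ... | j , j<k , r₁ with ↝-sound j (rs j<k) a y₁ K v r₁
  ... | y₂ , d₂ , h₂ = y₂ , ev-comp d₁ d₂ , HaltsWithin-mono (m<n⇒m≤1+n j<k) h₂
  stepEv-sound k ac e (vrec a b) ve x K v r =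
    rec-sound k ac e a b ve K v (fst x) (snd x) (sym (pair-fst-snd x)) r
  stepEv-sound k ac e (vmu a) _ x K v r with mu-sound k ac a x 0 K v r
  ... | n , d₀ , below , h = n , ev-mu d₀ (λ m → below m z≤n) , HaltsWithin-mono (n≤1+n k) h

  rec-sound : ∀ k → Acc _<_ k → ∀ e a b → view e ≡ vrec a b → ∀ K v u s →
              ∀ {x} → x ≡ pair u s → run (recStep K e a b u s) k ≡ final v →
              Returns (rec' (decode a) (decode b)) x K (suc k) v
  rec-sound k ac e a b _ K v u zero refl r with ↝-sound k ac a u K v r
  ... | y , d , h = y , ev-rec0 d , HaltsWithin-mono (n≤1+n k) h
  rec-sound k ac@(acc rs) e a b ve K v u (suc m) refl r with ↝-sound k ac e (pair u m) (FRec b u m ∷ K) v r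
  ... | w , dr , h₁ with HaltsWithin-pop h₁
  ... | j , j<k , r₁ with ↝-sound j (rs j<k) b (pair u (pair m w)) K v r₁
  ... | y , dg , h₂ = y , ev-recS {a = u} {m = m} (subst (λ c → Eval c (pair u m) w) (decode≡realize ve) dr) dg ,
                      HaltsWithin-mono (m<n⇒m≤1+n j<k) h₂

  mu-sound : ∀ k → Acc _<_ k → ∀ a x j K v → run (FMu a x j ∷ K , Ev a (pair x j)) k ≡ final v →
             MuReturns a x j K k v
  mu-sound k ac@(acc rs) a x j K v r with ↝-sound k ac a (pair x j) (FMu a x j ∷ K) v r
  ... | y , d , h with y | HaltsWithin-pop h
  ... | zero  | h' = j , d , (λ m j≤m m<j → ⊥-elim (<-irrefl refl (≤-<-trans j≤m m<j))) , h'
  ... | suc y' | (i , i<k , r₁) with mu-sound i (rs i<k) a x (suc j) K v r₁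
  ... | n , d₀ , below , h₂ = n , d₀ , below' , HaltsWithin-mono (<⇒≤ i<k) h₂
    where
    below' : ∀ m → j ≤ m → m < n → Σ ℕ λ k' → Eval (decode a) (pair x m) (suc k')
    below' m j≤m m<n with m ≟ j
    ... | yes refl = y' , d
    ... | no m≢j   = below m (≤∧≢⇒< j≤m (≢-sym m≢j)) m<n

ev-fst-pair : ∀ a b → Eval fst' (pair a b) a
ev-fst-pair a b = subst (Eval fst' (pair a b)) (fst-pair a b) ev-fst

ev-snd-pair : ∀ a b → Eval snd' (pair a b) b
ev-snd-pair a b = subst (Eval snd' (pair a b)) (snd-pair a b) ev-snd

cst : ℕ → Code
cst zero    = zero'
cst (suc k) = comp' succ' (cst k)

ev-cst : ∀ k {x} → Eval (cst k) x k
ev-cst zero    = ev-zero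
ev-cst (suc k) = ev-comp (ev-cst k) ev-succ

predC : Code
predC = comp' (rec' zero' (comp' fst' snd')) (pair' zero' id')

ev-pred : ∀ n → Eval predC n (pred n)
ev-pred n = ev-comp (ev-pair ev-zero ev-id) (ev-rec n)
  where
  ev-rec : ∀ n → Eval (rec' zero' (comp' fst' snd')) (pair 0 n) (pred n)
  ev-rec zero    = ev-rec0 {a = 0} ev-zero
  ev-rec (suc n) = ev-recS {a = 0} {m = n} (ev-rec n)
                     (ev-comp (ev-snd-pair 0 (pair n (pred n))) (ev-fst-pair n (pred n)))

-- ifz t z s x = (z x if t x = 0, s x otherwise).  The recursion unwinds to the
-- base case, so z x must be defined even when t x ≠ 0.
ifz : Code → Code → Code → Code
ifz t z s = comp' (rec' z (comp' s fst')) (pair' id' t)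

ev-ifz-zero : ∀ {t z s x v} → Eval t x 0 → Eval z x v → Eval (ifz t z s) x v
ev-ifz-zero {x = x} dt dz = ev-comp (ev-pair ev-id dt) (ev-rec0 {a = x} dz)

ev-ifz-suc : ∀ {t z s x v m} → Eval t x (suc m) → Eval s x v → (Σ ℕ λ w → Eval z x w) →
             Eval (ifz t z s) x v
ev-ifz-suc {z = z} {s} {x} {v} dt ds (w , dz) =
  ev-comp (ev-pair ev-id dt) (proj₂ (rec-total (suc _)))
  where
  rec-total : ∀ m → Σ ℕ λ w' → Eval (rec' z (comp' s fst')) (pair x m) w'
  rec-total zero    = w , ev-rec0 {a = x} dz
  rec-total (suc m) = v , ev-recS {a = x} {m = m} (proj₂ (rec-total m)) (ev-comp (ev-fst-pair x _) ds)

data Tm : Set where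
  tid                  : Tm
  tfst tsnd tsuc tpred : Tm → Tm
  tpair                : Tm → Tm → Tm
  tcst                 : ℕ → Tm
  tifz                 : Tm → Tm → Tm → Tm

⟦_⟧ : Tm → Code
⟦ tid ⟧         = id'
⟦ tfst t ⟧      = comp' fst' ⟦ t ⟧
⟦ tsnd t ⟧      = comp' snd' ⟦ t ⟧
⟦ tsuc t ⟧      = comp' succ' ⟦ t ⟧
⟦ tpred t ⟧     = comp' predC ⟦ t ⟧
⟦ tpair a b ⟧   = pair' ⟦ a ⟧ ⟦ b ⟧
⟦ tcst k ⟧      = cst k
⟦ tifz t z s ⟧  = ifz ⟦ t ⟧ ⟦ z ⟧ ⟦ s ⟧

ev-fst∘ : ∀ {c x n} → Eval c x n → Eval (comp' fst' c) x (fst n)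
ev-fst∘ d = ev-comp d ev-fst

ev-snd∘ : ∀ {c x n} → Eval c x n → Eval (comp' snd' c) x (snd n)
ev-snd∘ d = ev-comp d ev-snd

ev-suc∘ : ∀ {c x n} → Eval c x n → Eval (comp' succ' c) x (suc n)
ev-suc∘ d = ev-comp d ev-succ

ev-pred∘ : ∀ {c x n} → Eval c x n → Eval (comp' predC c) x (pred n)
ev-pred∘ {n = n} d = ev-comp d (ev-pred n)

ev-fst∘pair : ∀ {c x} a b → Eval c x (pair a b) → Eval (comp' fst' c) x a
ev-fst∘pair a b d = ev-comp d (ev-fst-pair a b)

ev-snd∘pair : ∀ {c x} a b → Eval c x (pair a b) → Eval (comp' snd' c) x b
ev-snd∘pair a b d = ev-comp d (ev-snd-pair a b)

⟦⟧-total : ∀ t → Total ⟦ t ⟧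
⟦⟧-total tid x = x , ev-id
⟦⟧-total (tfst t) x  = let y , d = ⟦⟧-total t x in fst y , ev-fst∘ d
⟦⟧-total (tsnd t) x  = let y , d = ⟦⟧-total t x in snd y , ev-snd∘ d
⟦⟧-total (tsuc t) x  = let y , d = ⟦⟧-total t x in suc y , ev-suc∘ d
⟦⟧-total (tpred t) x = let y , d = ⟦⟧-total t x in pred y , ev-pred∘ d
⟦⟧-total (tpair a b) x =
  let y , d = ⟦⟧-total a x ; y' , d' = ⟦⟧-total b x in pair y y' , ev-pair d d'
⟦⟧-total (tcst k) x = k , ev-cst k
⟦⟧-total (tifz t z s) x with ⟦⟧-total t x
... | zero  , dt = let w , dz = ⟦⟧-total z x in w , ev-ifz-zero dt dz
... | suc m , dt = let w , ds = ⟦⟧-total s x in w , ev-ifz-suc dt ds (⟦⟧-total z x)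

switch : Tm → List Tm → Tm → Tm
switch t []       d = d
switch t (b ∷ bs) d = tifz t b (switch (tpred t) bs d)

branch : List Tm → ℕ → Tm → Tm
branch []       n       d = d
branch (b ∷ bs) zero    d = b
branch (b ∷ bs) (suc n) d = branch bs n d

ev-switch : ∀ bs t d {x n v} → Eval ⟦ t ⟧ x n → Eval ⟦ branch bs n d ⟧ x v → Eval ⟦ switch t bs d ⟧ x v
ev-switch []       t d dt dv = dv
ev-switch (b ∷ bs) t d {n = zero}  dt dv = ev-ifz-zero dt dv
ev-switch (b ∷ bs) t d {x} {suc n} dt dv =
  ev-ifz-suc dt (ev-switch bs (tpred t) d (ev-pred∘ dt) dv) (⟦⟧-total b x)

-- Coding machine states, and a program computing one step

encodeFrame : Frame → ℕ
encodeFrame (FComp a)     = pair 0 a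
encodeFrame (FPair₁ b x)  = pair 1 (pair b x)
encodeFrame (FPair₂ a)    = pair 2 a
encodeFrame (FRec b a m)  = pair 3 (pair b (pair a m))
encodeFrame (FMu a x n)   = pair 4 (pair a (pair x n))

encodeStack : List Frame → ℕ
encodeStack []      = 0
encodeStack (F ∷ K) = suc (pair (encodeFrame F) (encodeStack K))

encodeCtrl : Ctrl → ℕ
encodeCtrl (Ev e x) = pair 0 (pair e x)
encodeCtrl (Ret v)  = pair 1 v

encodeState : State → ℕ
encodeState (K , c) = pair (encodeStack K) (encodeCtrl c)

tStack tCtrl tCtrlTag tCtrlArg tIndex tInput tIndexTag tIndexBody t0 : Tm
tStack     = tfst tid
tCtrl      = tsnd tid
tCtrlTag   = tfst tCtrl
tCtrlArg   = tsnd tCtrl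
tIndex     = tfst tCtrlArg
tInput     = tsnd tCtrlArg
tIndexTag  = tfst tIndex
tIndexBody = tsnd tIndex
t0         = tcst 0

-- onX codes the clause of stepEv for the shape vX.
onZero onSucc onId onFst onSnd onPair onComp onRec onMu : Tm
onZero = tpair tStack (tpair (tcst 1) t0)
onSucc = tpair tStack (tpair (tcst 1) (tsuc tInput))
onId   = tpair tStack (tpair (tcst 1) tInput)
onFst  = tpair tStack (tpair (tcst 1) (tfst tInput))
onSnd  = tpair tStack (tpair (tcst 1) (tsnd tInput))
onPair = tpair (tsuc (tpair (tpair (tcst 1) (tpair (tsnd tIndexBody) tInput)) tStack))
               (tpair t0 (tpair (tfst tIndexBody) tInput))
onComp = tpair (tsuc (tpair (tpair t0 (tfst tIndexBody)) tStack))
               (tpair t0 (tpair (tsnd tIndexBody) tInput))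
onRec  = tifz (tsnd tInput) (tpair tStack (tpair t0 (tpair (tfst tIndexBody) (tfst tInput))))
           (tpair (tsuc (tpair (tpair (tcst 3) (tpair (tsnd tIndexBody) (tpair (tfst tInput) (tpred (tsnd tInput)))))
                               tStack))
                  (tpair t0 (tpair tIndex (tpair (tfst tInput) (tpred (tsnd tInput))))))
onMu   = tpair (tsuc (tpair (tpair (tcst 4) (tpair tIndexBody (tpair tInput t0))) tStack))
               (tpair t0 (tpair tIndexBody (tpair tInput t0)))

tTop tFrame tRest tFrameTag tFrameArg tValue : Tm
tTop      = tpred tStack
tFrame    = tfst tTop
tRest     = tsnd tTop
tFrameTag = tfst tFrame
tFrameArg = tsnd tFrame
tValue    = tCtrlArg

-- retF codes the clause of step returning to a frame F.
retComp retPair₁ retPair₂ retRec retMu : Tm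
retComp  = tpair tRest (tpair t0 (tpair tFrameArg tValue))
retPair₁ = tpair (tsuc (tpair (tpair (tcst 2) tValue) tRest)) (tpair t0 tFrameArg)
retPair₂ = tpair tRest (tpair (tcst 1) (tpair tFrameArg tValue))
retRec   = tpair tRest (tpair t0 (tpair (tfst tFrameArg)
             (tpair (tfst (tsnd tFrameArg)) (tpair (tsnd (tsnd tFrameArg)) tValue))))
retMu    = tifz tValue (tpair tRest (tpair (tcst 1) (tsnd (tsnd tFrameArg))))
             (tpair (tsuc (tpair (tpair (tcst 4) (tpair (tfst tFrameArg)
                                   (tpair (tfst (tsnd tFrameArg)) (tsuc (tsnd (tsnd tFrameArg)))))) tRest))
                    (tpair t0 (tpair (tfst tFrameArg) (tpair (tfst (tsnd tFrameArg)) (tsuc (tsnd (tsnd tFrameArg)))))))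

evalBranches returnBranches : List Tm
evalBranches   = onZero ∷ onSucc ∷ onId ∷ onFst ∷ onSnd ∷ onPair ∷ onComp ∷ onRec ∷ onMu ∷ []
returnBranches = retComp ∷ retPair₁ ∷ retPair₂ ∷ retRec ∷ retMu ∷ []

returnTm : Tm
returnTm = tifz tStack tid (switch tFrameTag returnBranches retComp)

stepTm : Tm
stepTm = tifz tCtrlTag (switch tIndexTag evalBranches onZero) returnTm

module EvalStep (K : List Frame) (e x : ℕ) where
  X : ℕ
  X = encodeState (K , Ev e x)

  d-stack : Eval ⟦ tStack ⟧ X (encodeStack K)
  d-stack = ev-fst∘pair (encodeStack K) (encodeCtrl (Ev e x)) ev-id

  d-ctrl : Eval ⟦ tCtrl ⟧ X (pair 0 (pair e x))
  d-ctrl = ev-snd∘pair (encodeStack K) (encodeCtrl (Ev e x)) ev-id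

  d-ctrlArg : Eval ⟦ tCtrlArg ⟧ X (pair e x)
  d-ctrlArg = ev-snd∘pair 0 (pair e x) d-ctrl

  d-index : Eval ⟦ tIndex ⟧ X e
  d-index = ev-fst∘pair e x d-ctrlArg

  d-input : Eval ⟦ tInput ⟧ X x
  d-input = ev-snd∘pair e x d-ctrlArg

  d-body : ∀ {t r} → unpair e ≡ (t , r) → Eval ⟦ tIndexBody ⟧ X r
  d-body eq = subst (Eval ⟦ tIndexBody ⟧ X) (cong proj₂ eq) (ev-snd∘ d-index)

  viaBranch : ∀ {t r v} → unpair e ≡ (t , r) → Eval ⟦ branch evalBranches t onZero ⟧ X v →
              Eval ⟦ stepTm ⟧ X v
  viaBranch eq = ev-ifz-zero (ev-fst∘pair 0 (pair e x) d-ctrl)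
    ∘ ev-switch evalBranches tIndexTag onZero (subst (Eval ⟦ tIndexTag ⟧ X) (cong proj₁ eq) (ev-fst∘ d-index))

  ev-onRec : ∀ a b s → snd x ≡ s → Eval ⟦ tIndexBody ⟧ X (pair a b) →
             Eval ⟦ onRec ⟧ X (encodeState (recStep K e a b (fst x) s))
  ev-onRec a b zero sx db = ev-ifz-zero (subst (Eval ⟦ tsnd tInput ⟧ X) sx (ev-snd∘ d-input))
    (ev-pair d-stack (ev-pair (ev-cst 0) (ev-pair (ev-fst∘pair a b db) (ev-fst∘ d-input))))
  ev-onRec a b (suc m) sx db = ev-ifz-suc d-sx
    (ev-pair (ev-suc∘ (ev-pair (ev-pair (ev-cst 3) (ev-pair (ev-snd∘pair a b db) (ev-pair (ev-fst∘ d-input) (ev-pred∘ d-sx))))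
                               d-stack))
             (ev-pair (ev-cst 0) (ev-pair d-index (ev-pair (ev-fst∘ d-input) (ev-pred∘ d-sx)))))
    (⟦⟧-total (tpair tStack (tpair t0 (tpair (tfst tIndexBody) (tfst tInput)))) X)
    where
    d-sx : Eval ⟦ tsnd tInput ⟧ X (suc m)
    d-sx = subst (Eval ⟦ tsnd tInput ⟧ X) sx (ev-snd∘ d-input)

  ev-step : Eval ⟦ stepTm ⟧ X (encodeState (step (K , Ev e x)))
  ev-step with unpair e in eq
  ... | (0 , r) = viaBranch eq (ev-pair d-stack (ev-pair (ev-cst 1) (ev-cst 0)))
  ... | (1 , r) = viaBranch eq (ev-pair d-stack (ev-pair (ev-cst 1) (ev-suc∘ d-input)))
  ... | (2 , r) = viaBranch eq (ev-pair d-stack (ev-pair (ev-cst 1) d-input))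
  ... | (3 , r) = viaBranch eq (ev-pair d-stack (ev-pair (ev-cst 1) (ev-fst∘ d-input)))
  ... | (4 , r) = viaBranch eq (ev-pair d-stack (ev-pair (ev-cst 1) (ev-snd∘ d-input)))
  ... | (5 , r) = viaBranch eq
    (ev-pair (ev-suc∘ (ev-pair (ev-pair (ev-cst 1) (ev-pair (ev-snd∘ (d-body eq)) d-input)) d-stack))
             (ev-pair (ev-cst 0) (ev-pair (ev-fst∘ (d-body eq)) d-input)))
  ... | (6 , r) = viaBranch eq
    (ev-pair (ev-suc∘ (ev-pair (ev-pair (ev-cst 0) (ev-fst∘ (d-body eq))) d-stack))
             (ev-pair (ev-cst 0) (ev-pair (ev-snd∘ (d-body eq)) d-input)))
  ... | (7 , r) = viaBranch eq
    (ev-onRec (fst r) (snd r) (snd x) refl (subst (Eval ⟦ tIndexBody ⟧ X) (sym (pair-fst-snd r)) (d-body eq)))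
  ... | (8 , r) = viaBranch eq
    (ev-pair (ev-suc∘ (ev-pair (ev-pair (ev-cst 4) (ev-pair (d-body eq) (ev-pair d-input (ev-cst 0)))) d-stack))
             (ev-pair (ev-cst 0) (ev-pair (d-body eq) (ev-pair d-input (ev-cst 0)))))
  ... | (suc (suc (suc (suc (suc (suc (suc (suc (suc _)))))))) , r) =
    viaBranch eq (ev-pair d-stack (ev-pair (ev-cst 1) (ev-cst 0)))

module ReturnStep (v : ℕ) where
  X : List Frame → ℕ
  X K = encodeState (K , Ret v)

  d-stack : ∀ K → Eval ⟦ tStack ⟧ (X K) (encodeStack K)
  d-stack K = ev-fst∘pair (encodeStack K) (pair 1 v) ev-id

  d-ctrl : ∀ K → Eval ⟦ tCtrl ⟧ (X K) (pair 1 v)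
  d-ctrl K = ev-snd∘pair (encodeStack K) (pair 1 v) ev-id

  d-value : ∀ K → Eval ⟦ tValue ⟧ (X K) v
  d-value K = ev-snd∘pair 1 v (d-ctrl K)

  module Top (F : Frame) (K : List Frame) where
    Y : ℕ
    Y = X (F ∷ K)

    d-top : Eval ⟦ tTop ⟧ Y (pair (encodeFrame F) (encodeStack K))
    d-top = ev-pred∘ (d-stack (F ∷ K))

    d-frame : Eval ⟦ tFrame ⟧ Y (encodeFrame F)
    d-frame = ev-fst∘pair (encodeFrame F) (encodeStack K) d-top

    d-rest : Eval ⟦ tRest ⟧ Y (encodeStack K)
    d-rest = ev-snd∘pair (encodeFrame F) (encodeStack K) d-top

    viaFrame : ∀ t r {w} → encodeFrame F ≡ pair t r → Eval ⟦ branch returnBranches t retComp ⟧ Y w →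
               Eval ⟦ returnTm ⟧ Y w
    viaFrame t r eq d = ev-ifz-suc (d-stack (F ∷ K))
      (ev-switch returnBranches tFrameTag retComp (ev-fst∘pair t r (subst (Eval ⟦ tFrame ⟧ Y) eq d-frame)) d)
      (⟦⟧-total tid Y)

    d-frameArg : ∀ t r → encodeFrame F ≡ pair t r → Eval ⟦ tFrameArg ⟧ Y r
    d-frameArg t r eq = ev-snd∘pair t r (subst (Eval ⟦ tFrame ⟧ Y) eq d-frame)

  ev-return : ∀ K → Eval ⟦ returnTm ⟧ (X K) (encodeState (step (K , Ret v)))
  ev-return [] = ev-ifz-zero (d-stack []) ev-id
  ev-return (FComp a ∷ K) = viaFrame 0 a refl
    (ev-pair d-rest (ev-pair (ev-cst 0) (ev-pair (d-frameArg 0 a refl) (d-value (FComp a ∷ K)))))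
    where open Top (FComp a) K
  ev-return (FPair₁ b x ∷ K) = viaFrame 1 (pair b x) refl
    (ev-pair (ev-suc∘ (ev-pair (ev-pair (ev-cst 2) (d-value (FPair₁ b x ∷ K))) d-rest))
             (ev-pair (ev-cst 0) (d-frameArg 1 (pair b x) refl)))
    where open Top (FPair₁ b x) K
  ev-return (FPair₂ a ∷ K) = viaFrame 2 a refl
    (ev-pair d-rest (ev-pair (ev-cst 1) (ev-pair (d-frameArg 2 a refl) (d-value (FPair₂ a ∷ K)))))
    where open Top (FPair₂ a) K
  ev-return (FRec b a m ∷ K) = viaFrame 3 (pair b (pair a m)) refl
    (ev-pair d-rest (ev-pair (ev-cst 0) (ev-pair (ev-fst∘pair b (pair a m) d-args)
      (ev-pair (ev-fst∘pair a m d-am) (ev-pair (ev-snd∘pair a m d-am) (d-value (FRec b a m ∷ K)))))))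
    where
    open Top (FRec b a m) K
    d-args : Eval ⟦ tFrameArg ⟧ Y (pair b (pair a m))
    d-args = d-frameArg 3 (pair b (pair a m)) refl
    d-am : Eval ⟦ tsnd tFrameArg ⟧ Y (pair a m)
    d-am = ev-snd∘pair b (pair a m) d-args
  ev-return (FMu a x n ∷ K) = viaFrame 4 (pair a (pair x n)) refl (ev-retMu v refl)
    where
    open Top (FMu a x n) K
    d-args : Eval ⟦ tFrameArg ⟧ Y (pair a (pair x n))
    d-args = d-frameArg 4 (pair a (pair x n)) refl
    d-a : Eval ⟦ tfst tFrameArg ⟧ Y a
    d-a = ev-fst∘pair a (pair x n) d-args
    d-xn : Eval ⟦ tsnd tFrameArg ⟧ Y (pair x n)
    d-xn = ev-snd∘pair a (pair x n) d-args
    ev-retMu : ∀ v' → v ≡ v' → Eval ⟦ retMu ⟧ Y (encodeState (step (FMu a x n ∷ K , Ret v')))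
    ev-retMu zero v≡0 = ev-ifz-zero (subst (Eval ⟦ tValue ⟧ Y) v≡0 (d-value (FMu a x n ∷ K)))
      (ev-pair d-rest (ev-pair (ev-cst 1) (ev-snd∘pair x n d-xn)))
    ev-retMu (suc k) v≡1+k = ev-ifz-suc (subst (Eval ⟦ tValue ⟧ Y) v≡1+k (d-value (FMu a x n ∷ K)))
      (ev-pair (ev-suc∘ (ev-pair (ev-pair (ev-cst 4) (ev-pair d-a (ev-pair (ev-fst∘pair x n d-xn) (ev-suc∘ (ev-snd∘pair x n d-xn)))))
                                 d-rest))
               (ev-pair (ev-cst 0) (ev-pair d-a (ev-pair (ev-fst∘pair x n d-xn) (ev-suc∘ (ev-snd∘pair x n d-xn))))))
      (⟦⟧-total (tpair tRest (tpair (tcst 1) (tsnd (tsnd tFrameArg)))) Y)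

  ev-step : ∀ K → Eval ⟦ stepTm ⟧ (X K) (encodeState (step (K , Ret v)))
  ev-step K = ev-ifz-suc (ev-fst∘pair 1 v (d-ctrl K)) (ev-return K) (⟦⟧-total (switch tIndexTag evalBranches onZero) (X K))

ev-step : ∀ s → Eval ⟦ stepTm ⟧ (encodeState s) (encodeState (step s))
ev-step (K , Ev e x) = EvalStep.ev-step K e x
ev-step (K , Ret v)  = ReturnStep.ev-step v K

-- A universal program

runC : Code
runC = rec' id' (comp' ⟦ stepTm ⟧ (comp' snd' snd'))

ev-runC : ∀ s k → Eval runC (pair (encodeState s) k) (encodeState (run s k))
ev-runC s zero    = ev-rec0 {a = encodeState s} ev-id
ev-runC s (suc k) = subst (Eval runC (pair (encodeState s) (suc k))) (cong encodeState (sym (run-suc s k)))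
  (ev-recS {a = encodeState s} {m = k} (ev-runC s k)
    (ev-comp (ev-comp (ev-snd-pair (encodeState s) _) (ev-snd-pair k _)) (ev-step (run s k))))

IsFinal : State → Set
IsFinal s = Σ ℕ λ v → s ≡ final v

isFinal? : ∀ s → Dec (IsFinal s)
isFinal? ([] , Ret v)  = yes (v , refl)
isFinal? ([] , Ev e x) = no λ ()
isFinal? (F ∷ K , c)   = no λ ()

haltedTm : Tm
haltedTm = tifz (tfst tid) (tifz (tfst (tsnd tid)) (tcst 1) (tifz (tpred (tfst (tsnd tid))) (tcst 0) (tcst 1))) (tcst 1)

ev-halted-final : ∀ v → Eval ⟦ haltedTm ⟧ (encodeState (final v)) 0
ev-halted-final v = ev-ifz-zero (ev-fst∘pair 0 (pair 1 v) ev-id)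
  (ev-ifz-suc d-tag (ev-ifz-zero (ev-pred∘ d-tag) (ev-cst 0)) (⟦⟧-total (tcst 1) _))
  where
  d-tag : Eval ⟦ tfst (tsnd tid) ⟧ (encodeState (final v)) 1
  d-tag = ev-fst∘pair 1 v (ev-snd∘pair 0 (pair 1 v) ev-id)

ev-halted-running : ∀ s → ¬ IsFinal s → Σ ℕ λ k → Eval ⟦ haltedTm ⟧ (encodeState s) (suc k)
ev-halted-running ([] , Ret v) running = ⊥-elim (running (v , refl))
ev-halted-running ([] , Ev e x) _ = 0 ,
  ev-ifz-zero (ev-fst∘pair 0 (pair 0 (pair e x)) ev-id)
    (ev-ifz-zero (ev-fst∘pair 0 (pair e x) (ev-snd∘pair 0 (pair 0 (pair e x)) ev-id)) (ev-cst 1))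
ev-halted-running (F ∷ K , c) _ = 0 ,
  ev-ifz-suc (ev-fst∘pair (encodeStack (F ∷ K)) (encodeCtrl c) ev-id) (ev-cst 1)
    (⟦⟧-total (tifz (tfst (tsnd tid)) (tcst 1) (tifz (tpred (tfst (tsnd tid))) (tcst 0) (tcst 1))) _)

start : ℕ → ℕ → State
start e x = [] , Ev e x

startC : Code
startC = ⟦ tpair (tcst 0) (tpair (tcst 0) tid) ⟧

ev-startC : ∀ e x → Eval startC (pair e x) (encodeState (start e x))
ev-startC e x = ev-pair ev-zero (ev-pair ev-zero ev-id)

haltedAtC : Code
haltedAtC = comp' ⟦ haltedTm ⟧ (comp' runC (pair' (comp' startC fst') snd'))

ev-haltedAtC : ∀ e x k {b} → Eval ⟦ haltedTm ⟧ (encodeState (run (start e x) k)) b →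
               Eval haltedAtC (pair (pair e x) k) b
ev-haltedAtC e x k dh = ev-comp (ev-comp (ev-pair (ev-comp (ev-fst-pair (pair e x) k) (ev-startC e x))
                                                  (ev-snd-pair (pair e x) k))
                                         (ev-runC (start e x) k)) dh

resultC : Code
resultC = comp' snd' snd'

ev-resultC : ∀ v → Eval resultC (encodeState (final v)) v
ev-resultC v = ev-comp (ev-snd-pair 0 (pair 1 v)) (ev-snd-pair 1 v)

U : Code
U = comp' resultC (comp' runC (pair' startC (mu' haltedAtC)))

least-witness : ∀ {Q : ℕ → Set} → (∀ n → Dec (Q n)) → ∀ k → Q k →
                Σ ℕ λ n → Q n × n ≤ k × (∀ m → m < n → ¬ Q m)
least-witness Q? zero q = 0 , q , z≤n , λ _ ()
least-witness Q? (suc k) q with Q? 0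
... | yes q₀ = 0 , q₀ , z≤n , λ _ ()
... | no ¬q₀ with least-witness (Q? ∘ suc) k q
... | n , qn , n≤k , below = suc n , qn , s≤s n≤k , λ { zero _ → ¬q₀ ; (suc m) (s≤s m<n) → below m m<n }

run-final-≤ : ∀ s {j k v} → j ≤ k → run s j ≡ final v → run s k ≡ final v
run-final-≤ s {j} {k} {v} j≤k rj = begin
  run s k                 ≡⟨ cong (run s) (sym (m+[n∸m]≡n j≤k)) ⟩
  run s (j + (k ∸ j))     ≡⟨ run-+ s j (k ∸ j) ⟩
  run (run s j) (k ∸ j)   ≡⟨ cong (λ t → run t (k ∸ j)) rj ⟩
  run (final v) (k ∸ j)   ≡⟨ run-final v (k ∸ j) ⟩
  final v                 ∎
  where open ≡-Reasoning

final-injective : ∀ {v w} → final v ≡ final w → v ≡ w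
final-injective refl = refl

U-complete : ∀ e x y → Eval (decode e) x y → Eval U (pair e x) y
U-complete e x y d with Eval⇒↝ d []
... | k , rk with least-witness (isFinal? ∘ run (start e x)) k (y , rk)
... | k₀ , (y' , r₀) , k₀≤k , below =
  ev-comp (ev-comp (ev-pair (ev-startC e x) (ev-mu (ev-haltedAtC e x k₀ halted) running)) (ev-runC (start e x) k₀))
          (subst (Eval resultC _) y'≡y (subst (λ s → Eval resultC (encodeState s) y') (sym r₀) (ev-resultC y')))
  where
  y'≡y : y' ≡ y
  y'≡y = final-injective (trans (sym (run-final-≤ (start e x) k₀≤k r₀)) rk)
  halted : Eval ⟦ haltedTm ⟧ (encodeState (run (start e x) k₀)) 0
  halted = subst (λ s → Eval ⟦ haltedTm ⟧ (encodeState s) 0) (sym r₀) (ev-halted-final y')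
  running : ∀ m → m < k₀ → Σ ℕ λ b → Eval haltedAtC (pair (pair e x) m) (suc b)
  running m m<k₀ = let b , dh = ev-halted-running (run (start e x) m) (below m m<k₀)
                   in b , ev-haltedAtC e x m dh

U-sound : ∀ e x y → Eval U (pair e x) y → Eval (decode e) x y
U-sound e x y (ev-comp (ev-comp (ev-pair {a = a} d-start (ev-mu {n = n} d-halted _)) d-run) d-result)
  with isFinal? (run (start e x) n)
... | no running with () ← Eval-det d-halted (ev-haltedAtC e x n (proj₂ (ev-halted-running _ running))) refl
... | yes (v , rn) with ↝-sound n (<-wellFounded n) e x [] v rn
... | y' , d , j , _ , rj = subst (Eval (decode e) x) (trans y'≡v (sym y≡v)) d
  where
  a≡start : a ≡ encodeState (start e x)
  a≡start = Eval-det d-start (ev-startC e x) refl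
  y≡v : y ≡ v
  y≡v = Eval-det d-result (ev-resultC v)
          (trans (Eval-det d-run (ev-runC (start e x) n) (cong (λ a → pair a n) a≡start)) (cong encodeState rn))
  y'≡v : y' ≡ v
  y'≡v = final-injective (trans (sym (run-final y' j)) rj)

U-universal : ∀ e x y → Eval U (pair e x) y ⇔ φ e x y
U-universal e x y = mk⇔ (U-sound e x y) (U-complete e x y)

-- Kleene's recursion theorem

open Equivalence

quoteC : Code → Code
quoteC zero'       = zero'
quoteC succ'       = cst (pair 1 0)
quoteC id'         = cst (pair 2 0)
quoteC fst'        = cst (pair 3 0)
quoteC snd'        = cst (pair 4 0)
quoteC (pair' f g) = pair' (cst 5) (pair' (quoteC f) (quoteC g))
quoteC (comp' f g) = pair' (cst 6) (pair' (quoteC f) (quoteC g))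
quoteC (rec' f g)  = pair' (cst 7) (pair' (quoteC f) (quoteC g))
quoteC (mu' f)     = pair' (cst 8) (quoteC f)

ev-quoteC : ∀ c {x} → Eval (quoteC c) x (encode c)
ev-quoteC zero'       = ev-zero
ev-quoteC succ'       = ev-cst (pair 1 0)
ev-quoteC id'         = ev-cst (pair 2 0)
ev-quoteC fst'        = ev-cst (pair 3 0)
ev-quoteC snd'        = ev-cst (pair 4 0)
ev-quoteC (pair' f g) = ev-pair (ev-cst 5) (ev-pair (ev-quoteC f) (ev-quoteC g))
ev-quoteC (comp' f g) = ev-pair (ev-cst 6) (ev-pair (ev-quoteC f) (ev-quoteC g))
ev-quoteC (rec' f g)  = ev-pair (ev-cst 7) (ev-pair (ev-quoteC f) (ev-quoteC g))
ev-quoteC (mu' f)     = ev-pair (ev-cst 8) (ev-quoteC f)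

-- encode (cst (suc k)) = pair 6 (pair (pair 1 0) (encode (cst k)))
numeralRecC : Code
numeralRecC = rec' zero' (comp' (pair' (cst 6) (pair' (cst (pair 1 0)) id')) (comp' snd' snd'))

numeralC : Code
numeralC = comp' numeralRecC (pair' zero' id')

ev-numeralC : ∀ k → Eval numeralC k (encode (cst k))
ev-numeralC k = ev-comp (ev-pair ev-zero ev-id) (ev-rec k)
  where
  ev-rec : ∀ k → Eval numeralRecC (pair 0 k) (encode (cst k))
  ev-rec zero    = ev-rec0 {a = 0} ev-zero
  ev-rec (suc k) = ev-recS {a = 0} {m = k} (ev-rec k)
    (ev-comp (ev-comp (ev-snd-pair 0 (pair k (encode (cst k)))) (ev-snd-pair k (encode (cst k))))
             (ev-pair (ev-cst 6) (ev-pair (ev-cst (pair 1 0)) ev-id)))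

ev-comp-pair-id-inv : ∀ {c d y o} → Eval (comp' c (pair' d id')) y o →
                      Σ ℕ λ a → Eval d y a × Eval c (pair a y) o
ev-comp-pair-id-inv (ev-comp (ev-pair d-a ev-id) d-c) = _ , d-a , d-c

-- Indices of concrete programs are astronomically large numbers; keeping
-- them opaque prevents the typechecker from ever normalising one.
opaque
  indexOf : Code → ℕ
  indexOf = encode

  indexOf≡encode : ∀ c → indexOf c ≡ encode c
  indexOf≡encode c = refl

decode-indexOf : ∀ c → decode (indexOf c) ≡ c
decode-indexOf c = trans (cong decode (indexOf≡encode c)) (decode-encode c)

module _ (u : Code) (universal : ∀ e x y → Eval u (pair e x) y ⇔ φ e x y) where
  -- diag x computes y ↦ φ_{φ_x(x)}(y).
  diag : ℕ → Code
  diag x = comp' u (pair' (comp' u (pair' (cst x) (cst x))) id')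

  diagIndexC : Code
  diagIndexC = pair' (cst 6) (pair' (quoteC u) (pair' (cst 5)
                 (pair' (pair' (cst 6) (pair' (quoteC u) (pair' (cst 5) (pair' numeralC numeralC)))) (quoteC id'))))

  ev-diagIndexC : ∀ x → Eval diagIndexC x (indexOf (diag x))
  ev-diagIndexC x = subst (Eval diagIndexC x) (sym (indexOf≡encode (diag x))) $
    ev-pair (ev-cst 6) (ev-pair (ev-quoteC u) (ev-pair (ev-cst 5)
      (ev-pair (ev-pair (ev-cst 6) (ev-pair (ev-quoteC u) (ev-pair (ev-cst 5) (ev-pair (ev-numeralC x) (ev-numeralC x)))))
               (ev-quoteC id'))))

  recursion-theorem : (d : Code) (f : ℕ → ℕ) → (∀ x → Eval d x (f x)) →
                      Σ ℕ λ e → ∀ y o → φ e y o ⇔ φ (f e) y o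
  recursion-theorem d f ev-d = e , λ y o → mk⇔ fwd bwd
    where
    -- φ_v(v) = f e by the choice of v, so diag v computes φ_{f e}.
    v e : ℕ
    v = indexOf (comp' d diagIndexC)
    e = indexOf (diag v)

    ev-inner : ∀ y → Eval (comp' u (pair' (cst v) (cst v))) y (f e)
    ev-inner y = ev-comp (ev-pair (ev-cst v) (ev-cst v)) (from (universal v v (f e))
      (subst (λ c → Eval c v (f e)) (sym (decode-indexOf (comp' d diagIndexC)))
             (ev-comp (ev-diagIndexC v) (ev-d e))))

    fwd : ∀ {y o} → φ e y o → φ (f e) y o
    fwd {y} {o} d-e =
      let a , d-a , d-u = ev-comp-pair-id-inv (subst (λ c → Eval c y o) (decode-indexOf (diag v)) d-e)
      in to (universal (f e) y o) (subst (λ a → Eval u (pair a y) o) (Eval-det d-a (ev-inner y) refl) d-u)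

    bwd : ∀ {y o} → φ (f e) y o → φ e y o
    bwd {y} {o} d-fe = subst (λ c → Eval c y o) (sym (decode-indexOf (diag v)))
      (ev-comp (ev-pair (ev-inner y) ev-id) (from (universal (f e) y o) d-fe))

-- The arithmetical hierarchy

open IsEquivalence (⇔-isEquivalence {ℓ = 0ℓ}) using () renaming (sym to ⇔-sym; trans to ⇔-trans)

¬-cong-⇔ : ∀ {A B : Set} → A ⇔ B → (¬ A) ⇔ (¬ B)
¬-cong-⇔ A⇔B = mk⇔ (λ ¬a b → ¬a (from A⇔B b)) (λ ¬b a → ¬b (to A⇔B a))

-- underPairs n m applies m to the x in ⟨…⟨⟨x , y₁⟩ , y₂⟩ … , yₙ⟩, the shape of
-- the inputs of the matrix of a Σₙ formula.
underPairs : ℕ → Code → Code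
underPairs zero    m = m
underPairs (suc n) m = underPairs n (pair' (comp' m fst') snd')

underPairs-total : ∀ n m → Total m → Total (underPairs n m)
underPairs-total zero    m m-total = m-total
underPairs-total (suc n) m m-total = underPairs-total n _ λ z →
  let y , d = m-total (fst z) in pair y (snd z) , ev-pair (ev-comp ev-fst d) ev-snd

SigmaF-underPairs : ∀ n m (g : ℕ → ℕ) → (∀ x → Eval m x (g x)) →
                    ∀ c x → SigmaF n (comp' c (underPairs n m)) x ⇔ SigmaF n c (g x)
SigmaF-underPairs zero m g ev-m c x = mk⇔ to' (ev-comp (ev-m x))
  where
  to' : Eval (comp' c m) x 0 → Eval c (g x) 0
  to' (ev-comp d-m d-c) = subst (λ a → Eval c a 0) (Eval-det d-m (ev-m x) refl) d-c
SigmaF-underPairs (suc n) m g ev-m c x =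
  mk⇔ (λ (y , ¬s) → y , λ s → ¬s (from (IH y) s))
      (λ (y , ¬s) → y , λ s → ¬s (to (IH y) s))
  where
  m' : Code
  m' = pair' (comp' m fst') snd'
  ev-m' : ∀ z → Eval m' z (pair (g (fst z)) (snd z))
  ev-m' z = ev-pair (ev-comp ev-fst (ev-m (fst z))) ev-snd
  IH : ∀ y → SigmaF n (comp' c (underPairs n m')) (pair x y) ⇔ SigmaF n c (pair (g x) y)
  IH y = subst (λ z → SigmaF n (comp' c (underPairs n m')) (pair x y) ⇔ SigmaF n c z)
               (cong₂ (λ a b → pair (g a) b) (fst-pair x y) (snd-pair x y))
               (SigmaF-underPairs n m' _ ev-m' c (pair x y))

IsΣ⁰₂-section : ∀ n {R : ℕ → ℕ → Set} a → IsΣ⁰₂ n R → IsΣ⁰ n (R a)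
IsΣ⁰₂-section n a (c , c-total , R⇔) =
  comp' c (underPairs n m) , total , λ x → ⇔-trans (R⇔ a x) (⇔-sym (SigmaF-underPairs n m (pair a) ev-m c x))
  where
  m : Code
  m = pair' (cst a) id'
  ev-m : ∀ x → Eval m x (pair a x)
  ev-m x = ev-pair (ev-cst a) ev-id
  total : Total (comp' c (underPairs n m))
  total x = let y , d = underPairs-total n m (λ z → pair a z , ev-m z) x
                w , d' = c-total y
            in w , ev-comp d d'

IsΣ⁰⇒IsΠ⁰-complement : ∀ n {A B : ℕ → Set} → IsΣ⁰ n A → (∀ x → B x ⇔ (¬ A x)) → IsΠ⁰ n B
IsΣ⁰⇒IsΠ⁰-complement n (c , c-total , A⇔) B⇔¬A =
  c , c-total , λ x → ⇔-trans (B⇔¬A x) (¬-cong-⇔ (A⇔ x))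

SameW-sym : ∀ {e e'} → SameW e e' → SameW e' e
SameW-sym e~e' x = ⇔-sym (e~e' x)

φ⇔⇒SameW : ∀ {e e'} → (∀ x y → φ e x y ⇔ φ e' x y) → SameW e e'
φ⇔⇒SameW φ⇔ x = mk⇔ (λ (y , d) → y , to (φ⇔ x y) d) (λ (y , d) → y , from (φ⇔ x y) d)

reduction-fixed-point-impossible :
  ∀ {P : ℕ → Set} → (∀ e e' → SameW e e' → P e → P e') →
  ∀ {f : ℕ → ℕ} → (∀ x → (¬ P x) ⇔ P (f x)) → ∀ {e} → ¬ SameW e (f e)
reduction-fixed-point-impossible {P} P-ext {f} reduces {e} e~fe = ¬Pe Pe
  where
  ¬Pe : ¬ P e
  ¬Pe Pe = from (reduces e) (P-ext e (f e) e~fe Pe) Pe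
  Pe : P e
  Pe = P-ext (f e) e (SameW-sym e~fe) (to (reduces e) ¬Pe)

Π⁰-complete-index-set-complement-not-Π⁰ :
  ∀ n {P : ℕ → Set} → (∀ e e' → SameW e e' → P e → P e') →
  IsΠ⁰-complete n P → ¬ IsΠ⁰ n (λ e → ¬ P e)
Π⁰-complete-index-set-complement-not-Π⁰ n {P} P-ext (_ , complete) ¬P-Π⁰ =
  let d , f , ev-d , reduces = complete (λ e → ¬ P e) ¬P-Π⁰
      e , φe⇔φfe = recursion-theorem U U-universal d f ev-d
  in reduction-fixed-point-impossible P-ext reduces (φ⇔⇒SameW φe⇔φfe)

minimal⇒¬P⇔¬above :
  ∀ {P : ℕ → Set} {_⊑_ : ℕ → ℕ → Set} →
  (∀ a b c → a ⊑ b → b ⊑ c → a ⊑ c) →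
  (∀ a b → P a → P b → Σ ℕ λ c → P c × c ⊑ a × c ⊑ b) →
  (∀ a b → P a → a ⊑ b → P b) →
  ∀ {S} → P S → (∀ T → P T → ¬ (T ⊑ S × ¬ (S ⊑ T))) →
  ∀ x → (¬ P x) ⇔ (¬ S ⊑ x)
minimal⇒¬P⇔¬above ⊑-trans glb up {S} PS minimal x = mk⇔
  (λ ¬Px S⊑x → ¬Px (up S x PS S⊑x))
  (λ ¬S⊑x Px → let c , Pc , c⊑S , c⊑x = glb S x PS Px
               in minimal c Pc (c⊑S , λ S⊑c → ¬S⊑x (⊑-trans S c x S⊑c c⊑x)))

theorem4p24 : (P : ℕ → Set) (_⊑_ : ℕ → ℕ → Set) (n : ℕ)
    → (∀ e e' → SameW e e' → P e → P e')
    → (∀ a a' b b' → SameW a a' → SameW b b' → a ⊑ b → a' ⊑ b')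
    → (∀ a → a ⊑ a)
    → (∀ a b c → a ⊑ b → b ⊑ c → a ⊑ c)
    → (∀ a b → P a → P b → Σ ℕ λ c → P c × c ⊑ a × c ⊑ b)
    → (∀ a b → P a → a ⊑ b → P b)
    → IsΣ⁰₂ n _⊑_
    → IsΠ⁰-complete n P
    → ¬ (Σ ℕ λ S → P S × (∀ T → P T → ¬ (T ⊑ S × ¬ (S ⊑ T))))
theorem4p24 P _⊑_ n P-ext _ _ ⊑-trans glb up ⊑-Σ⁰ P-complete (S , PS , minimal) =
  Π⁰-complete-index-set-complement-not-Π⁰ n P-ext P-complete
    (IsΣ⁰⇒IsΠ⁰-complement n (IsΣ⁰₂-section n S ⊑-Σ⁰) (minimal⇒¬P⇔¬above ⊑-trans glb up PS minimal))
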